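{- Let $\mathcal{H}$ be a finite set of positive integers. Then $$Z(S_{\mathcal H};\{\mathrm{cent}(\mathcal H)\},\emptyset;t,y)=y\prod_{h\in\mathcal H}\big(yt\,(yt+1)^h+(y+t)^h\big),$$ $$Z(S_{\mathcal H};\emptyset,\{\mathrm{cent}(\mathcal H)\};t,y)=\prod_{h\in\mathcal H}\big(y\,(yt+1)^h+t\,(y+t)^h\big).$$
   Context: For a simple graph $G$ and disjoint $B,C\subseteq V(G)$, $Z(G;B,C;t,y)=\sum_{S:\,B\subseteq S\subseteq V(G)\setminus C} t^{|E_G(S)|+|E_G(\bar S)|}y^{|S|}$, where $\bar S=V(G)\setminus S$ and $E_G(S)$ (resp. $E_G(\bar S)$) is the set of edges with both endpoints in $S$ (resp. $\bar S$). $S_n$ denotes the star with $n$ leaves. The graph $S_{\mathcal H}$ is obtained from the disjoint union of the stars $S_h$, $h\in\mathcal H$, and a new vertex $\mathrm{cent}(\mathcal H)$, by adding an edge between $\mathrm{cent}(\mathcal H)$ and the center of each star $S_h$. -}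

module Defs where

open import Level using (Level)
open import Data.Nat using (ℕ; zero; suc) renaming (_+_ to _+ℕ_)
open import Data.Bool using (Bool; true; false; if_then_else_)
import Data.Bool as B
open import Data.Fin using (Fin; zero; suc; _↑ˡ_; _↑ʳ_)
open import Data.List using (List; []; _∷_; map; _++_; filter; length; allFin)
open import Data.Product using (_×_; _,_; proj₁; proj₂)
open import Data.Vec using (Vec; []; _∷_; lookup; replicate)
open import Data.Fin.Subset using (Subset; _⊆_; ∁; ∣_∣)
open import Data.Fin.Subset.Properties using (_⊆?_)
open import Relation.Nullary using (does; _×-dec_)
open import Algebra.Bundles using (CommutativeSemiring)

-- A (finite, simple) graph on the vertex set Fin n, given by its list of
-- edges; each edge is an (unordered) pair of distinct vertices listed once.
record Graph : Set where
  constructor mkGraph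
  field
    nV    : ℕ
    edges : List (Fin nV × Fin nV)
open Graph public

allSubsets : (n : ℕ) → List (Subset n)
allSubsets zero    = [] ∷ []
allSubsets (suc n) = map (true ∷_) (allSubsets n) ++ map (false ∷_) (allSubsets n)

-- number of edges with both ends in S plus number with both ends in V∖S
-- (i.e. |E_G(S)| + |E_G(S̄)|)
monoEdges : (G : Graph) → Subset (nV G) → ℕ
monoEdges G S =
  length (filter (λ e → lookup S (proj₁ e) B.≟ lookup S (proj₂ e)) (edges G))

admissible : (G : Graph) → (Bs Cs : Subset (nV G)) → List (Subset (nV G))
admissible G Bs Cs =
  filter (λ S → (Bs ⊆? S) ×-dec (S ⊆? ∁ Cs)) (allSubsets (nV G))

module Poly {c ℓ : Level} (R : CommutativeSemiring c ℓ) where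
  open CommutativeSemiring R

  pow : Carrier → ℕ → Carrier
  pow x zero    = 1#
  pow x (suc k) = x * pow x k

  sumR : List Carrier → Carrier
  sumR []       = 0#
  sumR (x ∷ xs) = x + sumR xs

  prodR : List Carrier → Carrier
  prodR []       = 1#
  prodR (x ∷ xs) = x * prodR xs

  Z : (G : Graph) → (Bs Cs : Subset (nV G)) → Carrier → Carrier → Carrier
  Z G Bs Cs t y =
    sumR (map (λ S → pow t (monoEdges G S) * pow y ∣ S ∣) (admissible G Bs Cs))

starEdges : (h : ℕ) → List (Fin (suc h) × Fin (suc h))
starEdges h = map (λ i → (zero , suc i)) (allFin h)

forestSize : List ℕ → ℕ
forestSize []      = 0
forestSize (h ∷ H) = suc h +ℕ forestSize H

forestEdges : (H : List ℕ) → List (Fin (forestSize H) × Fin (forestSize H))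
forestEdges []      = []
forestEdges (h ∷ H) =
  map (λ e → (proj₁ e ↑ˡ forestSize H , proj₂ e ↑ˡ forestSize H)) (starEdges h)
  ++ map (λ e → (suc h ↑ʳ proj₁ e , suc h ↑ʳ proj₂ e)) (forestEdges H)

forestCentres : (H : List ℕ) → List (Fin (forestSize H))
forestCentres []      = []
forestCentres (h ∷ H) = (zero ↑ˡ forestSize H) ∷ map (suc h ↑ʳ_) (forestCentres H)

starsGraph : List ℕ → Graph
starsGraph H = mkGraph (suc (forestSize H))
  (map (λ e → (suc (proj₁ e) , suc (proj₂ e))) (forestEdges H)
   ++ map (λ c → (zero , suc c)) (forestCentres H))

cent : (H : List ℕ) → Fin (nV (starsGraph H))
cent H = zero

singleton : {n : ℕ} → Fin n → Subset n
singleton {suc n} zero    = true ∷ replicate n false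
singleton {suc n} (suc i) = false ∷ singleton i

emptySet : (n : ℕ) → Subset n
emptySet n = replicate n false

-- The weight t^(monochromatic edges) y^|S| is a product of one factor per edge and one per vertex.
-- Once the colour b of cent(H) is fixed, the stars interact only through their edge to cent(H), so
-- the sum over the colourings of the forest factors into one sum per star.  In a star S_h whose
-- centre has colour d, each leaf contributes independently, (y t + 1) if d is "in S" and (y + t)
-- otherwise, and summing over d with the weight of the edge to cent(H) gives the factors of the
-- theorem; the colour of cent(H) itself contributes y or 1.
module Submission where

open import Defs
open import Level using (Level)
open import Data.Nat using (ℕ; _≤_; zero; suc) renaming (_+_ to _+ℕ_)
open import Data.Bool using (Bool; true; false; if_then_else_)
import Data.Bool as Bool
open import Data.Empty using (⊥-elim)
open import Data.Fin using (Fin; zero; suc; _↑ˡ_; _↑ʳ_)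
open import Data.Fin.Subset using (Subset; ∣_∣; ∁; _⊆_)
open import Data.Fin.Subset.Properties using (_⊆?_; ∉⊥; ⊥⊆; x∉p⇒x∈∁p)
open import Data.List using (List; []; _∷_; map; _++_; filter; length; allFin; tabulate)
import Data.List.Properties as List
open import Data.List.Relation.Unary.All using (All; universal)
open import Data.List.Relation.Unary.All.Properties using (map⁺)
open import Data.List.Relation.Unary.Unique.Propositional using (Unique)
open import Data.Product using (_×_; _,_; proj₁; proj₂)
open import Data.Vec using (Vec; []; _∷_; lookup; here; there) renaming (_++_ to _++ᵥ_)
open import Data.Vec.Properties using (lookup-++ˡ; lookup-++ʳ)
open import Function using (_∘_)
open import Relation.Nullary using (¬_; does; _×-dec_)
open import Relation.Unary using (Pred; Decidable)
open import Relation.Binary.PropositionalEquality as ≡ using (_≡_; _≗_)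
open import Algebra.Bundles using (CommutativeSemiring)

admissible-containing-0 : ∀ n es →
  admissible (mkGraph (suc n) es) (singleton zero) (emptySet (suc n)) ≡ map (true ∷_) (allSubsets n)
admissible-containing-0 n es = begin
  filter Q? (map (true ∷_) (allSubsets n) ++ map (false ∷_) (allSubsets n))
    ≡⟨ List.filter-++ Q? (map (true ∷_) (allSubsets n)) _ ⟩
  filter Q? (map (true ∷_) (allSubsets n)) ++ filter Q? (map (false ∷_) (allSubsets n))
    ≡⟨ ≡.cong₂ _++_ (List.filter-all Q? (map⁺ (universal accepted (allSubsets n))))
                    (List.filter-none Q? (map⁺ (universal rejected (allSubsets n)))) ⟩
  map (true ∷_) (allSubsets n) ++ []
    ≡⟨ List.++-identityʳ _ ⟩
  map (true ∷_) (allSubsets n) ∎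
  where
  open ≡.≡-Reasoning
  Q? = λ (S : Subset (suc n)) → (singleton zero ⊆? S) ×-dec (S ⊆? ∁ (emptySet (suc n)))
  contains-0 : ∀ v → singleton zero ⊆ (true ∷ v)
  contains-0 v here      = here
  contains-0 v (there p) = ⊥-elim (∉⊥ p)
  accepted : ∀ v → singleton zero ⊆ (true ∷ v) × (true ∷ v) ⊆ ∁ (emptySet (suc n))
  accepted v = contains-0 v , λ _ → x∉p⇒x∈∁p ∉⊥
  rejected : ∀ v → ¬ (singleton zero ⊆ (false ∷ v) × (false ∷ v) ⊆ ∁ (emptySet (suc n)))
  rejected v (sub , _) with sub here
  ... | ()

admissible-avoiding-0 : ∀ n es →
  admissible (mkGraph (suc n) es) (emptySet (suc n)) (singleton zero) ≡ map (false ∷_) (allSubsets n)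
admissible-avoiding-0 n es = begin
  filter Q? (map (true ∷_) (allSubsets n) ++ map (false ∷_) (allSubsets n))
    ≡⟨ List.filter-++ Q? (map (true ∷_) (allSubsets n)) _ ⟩
  filter Q? (map (true ∷_) (allSubsets n)) ++ filter Q? (map (false ∷_) (allSubsets n))
    ≡⟨ ≡.cong₂ _++_ (List.filter-none Q? (map⁺ (universal rejected (allSubsets n))))
                    (List.filter-all Q? (map⁺ (universal accepted (allSubsets n)))) ⟩
  map (false ∷_) (allSubsets n) ∎
  where
  open ≡.≡-Reasoning
  Q? = λ (S : Subset (suc n)) → (emptySet (suc n) ⊆? S) ×-dec (S ⊆? ∁ (singleton zero))
  avoids-0 : ∀ v → (false ∷ v) ⊆ ∁ (singleton zero)
  avoids-0 v (there p) = there (x∉p⇒x∈∁p ∉⊥)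
  accepted : ∀ v → emptySet (suc n) ⊆ (false ∷ v) × (false ∷ v) ⊆ ∁ (singleton zero)
  accepted v = ⊥⊆ , avoids-0 v
  rejected : ∀ v → ¬ (emptySet (suc n) ⊆ (true ∷ v) × (true ∷ v) ⊆ ∁ (singleton zero))
  rejected v (_ , sub) with sub here
  ... | ()

module Sums {c ℓ : Level} (R : CommutativeSemiring c ℓ) where
  open CommutativeSemiring R hiding (zero)
  open Poly R
  open import Algebra.Properties.CommutativeSemigroup *-commutativeSemigroup
    using (interchange)
  open import Relation.Binary.Reasoning.Setoid setoid

  pow-cong : ∀ {x x′} n → x ≈ x′ → pow x n ≈ pow x′ n
  pow-cong zero    x≈x′ = refl
  pow-cong (suc n) x≈x′ = *-cong x≈x′ (pow-cong n x≈x′)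

  sumR-++ : ∀ xs ys → sumR (xs ++ ys) ≈ sumR xs + sumR ys
  sumR-++ []       ys = sym (+-identityˡ _)
  sumR-++ (x ∷ xs) ys = trans (+-congˡ (sumR-++ xs ys)) (sym (+-assoc _ _ _))

  prodR-++ : ∀ xs ys → prodR (xs ++ ys) ≈ prodR xs * prodR ys
  prodR-++ []       ys = sym (*-identityˡ _)
  prodR-++ (x ∷ xs) ys = trans (*-congˡ (prodR-++ xs ys)) (sym (*-assoc _ _ _))

  module _ {a} {A : Set a} where

    sumR-cong : ∀ {f g : A → Carrier} → (∀ x → f x ≈ g x) → ∀ xs → sumR (map f xs) ≈ sumR (map g xs)
    sumR-cong f≈g []       = refl
    sumR-cong f≈g (x ∷ xs) = +-cong (f≈g x) (sumR-cong f≈g xs)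

    *-sumR : ∀ k (f : A → Carrier) xs → k * sumR (map f xs) ≈ sumR (map (λ x → k * f x) xs)
    *-sumR k f []       = zeroʳ k
    *-sumR k f (x ∷ xs) = trans (distribˡ k _ _) (+-congˡ (*-sumR k f xs))

    sumR-* : ∀ k (f : A → Carrier) xs → sumR (map f xs) * k ≈ sumR (map (λ x → f x * k) xs)
    sumR-* k f xs = trans (*-comm _ k) (trans (*-sumR k f xs) (sumR-cong (λ x → *-comm k (f x)) xs))

    pow-length-filter : ∀ {p} {Q : Pred A p} (Q? : Decidable Q) x es →
      pow x (length (filter Q? es)) ≈ prodR (map (λ e → if does (Q? e) then x else 1#) es)
    pow-length-filter Q? x []       = refl
    pow-length-filter Q? x (e ∷ es) with does (Q? e)
    ... | true  = *-congˡ (pow-length-filter Q? x es)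
    ... | false = trans (pow-length-filter Q? x es) (sym (*-identityˡ _))

  sumR-allSubsets-suc : ∀ n (f : Subset (suc n) → Carrier) →
    sumR (map f (allSubsets (suc n))) ≈
      sumR (map (f ∘ (true ∷_)) (allSubsets n)) + sumR (map (f ∘ (false ∷_)) (allSubsets n))
  sumR-allSubsets-suc n f = begin
    sumR (map f (map (true ∷_) A ++ map (false ∷_) A))
      ≡⟨ ≡.cong sumR (List.map-++ f (map (true ∷_) A) _) ⟩
    sumR (map f (map (true ∷_) A) ++ map f (map (false ∷_) A))
      ≈⟨ sumR-++ (map f (map (true ∷_) A)) _ ⟩
    sumR (map f (map (true ∷_) A)) + sumR (map f (map (false ∷_) A))
      ≡⟨ ≡.cong₂ _+_ (≡.cong sumR (≡.sym (List.map-∘ A))) (≡.cong sumR (≡.sym (List.map-∘ A))) ⟩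
    sumR (map (f ∘ (true ∷_)) A) + sumR (map (f ∘ (false ∷_)) A) ∎
    where A = allSubsets n

  sumR-allSubsets-++ : ∀ m n {f : Subset (m +ℕ n) → Carrier} {g h} →
    (∀ xs ys → f (xs ++ᵥ ys) ≈ g xs * h ys) →
    sumR (map f (allSubsets (m +ℕ n))) ≈ sumR (map g (allSubsets m)) * sumR (map h (allSubsets n))
  sumR-allSubsets-++ zero n {f} {g} {h} f≈gh = begin
    sumR (map f (allSubsets n))                     ≈⟨ sumR-cong (f≈gh []) (allSubsets n) ⟩
    sumR (map (λ ys → g [] * h ys) (allSubsets n))  ≈⟨ *-sumR (g []) h (allSubsets n) ⟨
    g [] * sumR (map h (allSubsets n))              ≈⟨ *-congʳ (+-identityʳ (g [])) ⟨
    (g [] + 0#) * sumR (map h (allSubsets n))       ∎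
  sumR-allSubsets-++ (suc m) n {f} {g} {h} f≈gh = begin
    sumR (map f (allSubsets (suc (m +ℕ n))))
      ≈⟨ sumR-allSubsets-suc (m +ℕ n) f ⟩
    sumR (map (f ∘ (true ∷_)) (allSubsets (m +ℕ n))) + sumR (map (f ∘ (false ∷_)) (allSubsets (m +ℕ n)))
      ≈⟨ +-cong (sumR-allSubsets-++ m n (f≈gh ∘ (true ∷_))) (sumR-allSubsets-++ m n (f≈gh ∘ (false ∷_))) ⟩
    sumR (map (g ∘ (true ∷_)) (allSubsets m)) * H + sumR (map (g ∘ (false ∷_)) (allSubsets m)) * H
      ≈⟨ distribʳ H _ _ ⟨
    (sumR (map (g ∘ (true ∷_)) (allSubsets m)) + sumR (map (g ∘ (false ∷_)) (allSubsets m))) * H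
      ≈⟨ *-congʳ (sumR-allSubsets-suc m g) ⟨
    sumR (map g (allSubsets (suc m))) * H ∎
    where H = sumR (map h (allSubsets n))

  vprod : ∀ {n} → (Bool → Carrier) → Vec Bool n → Carrier
  vprod g []      = 1#
  vprod g (b ∷ v) = g b * vprod g v

  vprod-++ : ∀ {m n} g (xs : Vec Bool m) (ys : Vec Bool n) → vprod g (xs ++ᵥ ys) ≈ vprod g xs * vprod g ys
  vprod-++ g []       ys = sym (*-identityˡ _)
  vprod-++ g (x ∷ xs) ys = trans (*-congˡ (vprod-++ g xs ys)) (sym (*-assoc _ _ _))

  vprod-* : ∀ {n} f g (v : Vec Bool n) → vprod f v * vprod g v ≈ vprod (λ b → f b * g b) v
  vprod-* f g []      = *-identityˡ 1#
  vprod-* f g (b ∷ v) = trans (interchange _ _ _ _) (*-congˡ (vprod-* f g v))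

  prodR-allFin-lookup : ∀ {n} g (v : Vec Bool n) → prodR (map (g ∘ lookup v) (allFin n)) ≡ vprod g v
  prodR-allFin-lookup g []      = ≡.refl
  prodR-allFin-lookup g (b ∷ v) = ≡.cong (g b *_) (≡.trans (≡.cong prodR shift) (prodR-allFin-lookup g v))
    where
    shift : map (g ∘ lookup (b ∷ v)) (tabulate suc) ≡ map (g ∘ lookup v) (allFin _)
    shift = ≡.trans (List.map-tabulate suc _) (≡.sym (List.map-tabulate (λ i → i) _))

  pow-∣∣ : ∀ {n} x (v : Vec Bool n) → pow x ∣ v ∣ ≈ vprod (λ b → if b then x else 1#) v
  pow-∣∣ x []          = refl
  pow-∣∣ x (true ∷ v)  = *-congˡ (pow-∣∣ x v)
  pow-∣∣ x (false ∷ v) = trans (pow-∣∣ x v) (sym (*-identityˡ _))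

  sumR-allSubsets-vprod : ∀ g n → sumR (map (vprod g) (allSubsets n)) ≈ pow (g true + g false) n
  sumR-allSubsets-vprod g zero    = +-identityʳ 1#
  sumR-allSubsets-vprod g (suc n) = begin
    sumR (map (vprod g) (allSubsets (suc n)))
      ≈⟨ sumR-allSubsets-suc n (vprod g) ⟩
    sumR (map (λ v → g true * vprod g v) A) + sumR (map (λ v → g false * vprod g v) A)
      ≈⟨ +-cong (*-sumR (g true) (vprod g) A) (*-sumR (g false) (vprod g) A) ⟨
    g true * sumR (map (vprod g) A) + g false * sumR (map (vprod g) A)
      ≈⟨ distribʳ _ _ _ ⟨
    (g true + g false) * sumR (map (vprod g) A)
      ≈⟨ *-congˡ (sumR-allSubsets-vprod g n) ⟩
    (g true + g false) * pow (g true + g false) n ∎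
    where A = allSubsets n

module StarsWeights {c ℓ : Level} (R : CommutativeSemiring c ℓ) (t y : CommutativeSemiring.Carrier R) where
  open CommutativeSemiring R hiding (zero)
  open Poly R
  open Sums R
  open import Algebra.Properties.CommutativeSemigroup *-commutativeSemigroup
    using (interchange; x∙yz≈y∙xz)
  open import Relation.Binary.Reasoning.Setoid setoid

  agree : Bool → Bool → Carrier
  agree a b = if does (a Bool.≟ b) then t else 1#

  mark : Bool → Carrier
  mark b = if b then y else 1#

  edgeWeight : ∀ {n} → (Fin n → Bool) → List (Fin n × Fin n) → Carrier
  edgeWeight col es = prodR (map (λ e → agree (col (proj₁ e)) (col (proj₂ e))) es)

  coneWeight : ∀ {n} → Bool → (Fin n → Bool) → List (Fin n) → Carrier
  coneWeight b col cs = prodR (map (agree b ∘ col) cs)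

  weight : (G : Graph) → Subset (nV G) → Carrier
  weight G S = pow t (monoEdges G S) * pow y ∣ S ∣

  weight-factors : ∀ G S → weight G S ≈ edgeWeight (lookup S) (edges G) * vprod mark S
  weight-factors G S = *-cong (pow-length-filter _ t (edges G)) (pow-∣∣ y S)

  edgeWeight-++ : ∀ {n} (col : Fin n → Bool) es fs →
    edgeWeight col (es ++ fs) ≈ edgeWeight col es * edgeWeight col fs
  edgeWeight-++ col es fs =
    trans (reflexive (≡.cong prodR (List.map-++ w es fs))) (prodR-++ (map w es) (map w fs))
    where w = λ (e : Fin _ × Fin _) → agree (col (proj₁ e)) (col (proj₂ e))

  edgeWeight-map : ∀ {m n} (col : Fin n → Bool) (f : Fin m → Fin n) es →
    edgeWeight col (map (λ e → f (proj₁ e) , f (proj₂ e)) es) ≡ edgeWeight (col ∘ f) es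
  edgeWeight-map col f es = ≡.cong prodR (≡.sym (List.map-∘ es))

  edgeWeight-cong : ∀ {n} {col col′ : Fin n → Bool} → col ≗ col′ → ∀ es →
    edgeWeight col es ≡ edgeWeight col′ es
  edgeWeight-cong eq es = ≡.cong prodR (List.map-cong (λ e → ≡.cong₂ agree (eq (proj₁ e)) (eq (proj₂ e))) es)

  edgeWeight-cone : ∀ {n} b (v : Vec Bool n) cs →
    edgeWeight (lookup (b ∷ v)) (map (λ c → zero , suc c) cs) ≡ coneWeight b (lookup v) cs
  edgeWeight-cone b v cs = ≡.cong prodR (≡.sym (List.map-∘ cs))

  coneWeight-map : ∀ {m n} b (col : Fin n → Bool) (f : Fin m → Fin n) cs →
    coneWeight b col (map f cs) ≡ coneWeight b (col ∘ f) cs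
  coneWeight-map b col f cs = ≡.cong prodR (≡.sym (List.map-∘ cs))

  coneWeight-cong : ∀ {n} b {col col′ : Fin n → Bool} → col ≗ col′ → ∀ cs →
    coneWeight b col cs ≡ coneWeight b col′ cs
  coneWeight-cong b eq cs = ≡.cong prodR (List.map-cong (≡.cong (agree b) ∘ eq) cs)

  leafFactor : Bool → Carrier
  leafFactor true  = y * t + 1#
  leafFactor false = y + t

  starFactor : Bool → ℕ → Carrier
  starFactor true  h = (y * t) * pow (y * t + 1#) h + pow (y + t) h
  starFactor false h = y * pow (y * t + 1#) h + t * pow (y + t) h

  leafWeight : Bool → Bool → Carrier
  leafWeight d e = agree d e * mark e

  leafWeight-sum : ∀ d → leafWeight d true + leafWeight d false ≈ leafFactor d
  leafWeight-sum true  = +-cong (*-comm t y) (*-identityˡ 1#)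
  leafWeight-sum false = +-cong (*-identityˡ y) (*-identityʳ t)

  leafSum : ∀ h d → sumR (map (vprod (leafWeight d)) (allSubsets h)) ≈ pow (leafFactor d) h
  leafSum h d = trans (sumR-allSubsets-vprod (leafWeight d) h) (pow-cong h (leafWeight-sum d))

  starWeight : ∀ h → Bool → Vec Bool (suc h) → Carrier
  starWeight h b xs = (edgeWeight (lookup xs) (starEdges h) * agree b (lookup xs zero)) * vprod mark xs

  starWeight-∷ : ∀ h b d (ls : Vec Bool h) →
    starWeight h b (d ∷ ls) ≈ (agree b d * mark d) * vprod (leafWeight d) ls
  starWeight-∷ h b d ls = begin
    (edgeWeight (lookup (d ∷ ls)) (starEdges h) * agree b d) * (mark d * vprod mark ls)
      ≡⟨ ≡.cong (λ w → (w * agree b d) * (mark d * vprod mark ls))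
           (≡.trans (edgeWeight-cone d ls (allFin h)) (prodR-allFin-lookup (agree d) ls)) ⟩
    (vprod (agree d) ls * agree b d) * (mark d * vprod mark ls)
      ≈⟨ *-congʳ (*-comm _ _) ⟩
    (agree b d * vprod (agree d) ls) * (mark d * vprod mark ls)
      ≈⟨ interchange _ _ _ _ ⟩
    (agree b d * mark d) * (vprod (agree d) ls * vprod mark ls)
      ≈⟨ *-congˡ (vprod-* (agree d) mark ls) ⟩
    (agree b d * mark d) * vprod (leafWeight d) ls ∎

  starFactor-≈ : ∀ b h →
    (agree b true * mark true) * pow (leafFactor true) h
      + (agree b false * mark false) * pow (leafFactor false) h ≈ starFactor b h
  starFactor-≈ true  h = +-cong (*-congʳ (*-comm t y)) (trans (*-congʳ (*-identityˡ 1#)) (*-identityˡ _))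
  starFactor-≈ false h = +-cong (*-congʳ (*-identityˡ y)) (*-congʳ (*-identityʳ t))

  starSum : ∀ h b → sumR (map (starWeight h b) (allSubsets (suc h))) ≈ starFactor b h
  starSum h b = begin
    sumR (map (starWeight h b) (allSubsets (suc h)))
      ≈⟨ sumR-allSubsets-suc h (starWeight h b) ⟩
    sumR (map (starWeight h b ∘ (true ∷_)) A) + sumR (map (starWeight h b ∘ (false ∷_)) A)
      ≈⟨ +-cong (sumR-cong (starWeight-∷ h b true) A) (sumR-cong (starWeight-∷ h b false) A) ⟩
    sumR (map (λ v → k true * vprod (leafWeight true) v) A)
      + sumR (map (λ v → k false * vprod (leafWeight false) v) A)
      ≈⟨ +-cong (*-sumR (k true) (vprod (leafWeight true)) A) (*-sumR (k false) (vprod (leafWeight false)) A) ⟨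
    k true * sumR (map (vprod (leafWeight true)) A) + k false * sumR (map (vprod (leafWeight false)) A)
      ≈⟨ +-cong (*-congˡ (leafSum h true)) (*-congˡ (leafSum h false)) ⟩
    k true * pow (leafFactor true) h + k false * pow (leafFactor false) h
      ≈⟨ starFactor-≈ b h ⟩
    starFactor b h ∎
    where
    A = allSubsets h
    k = λ d → agree b d * mark d

  forestWeight : ∀ H → Bool → Subset (forestSize H) → Carrier
  forestWeight H b v =
    (edgeWeight (lookup v) (forestEdges H) * coneWeight b (lookup v) (forestCentres H)) * vprod mark v

  module _ (h : ℕ) (H : List ℕ) (xs : Vec Bool (suc h)) (ys : Vec Bool (forestSize H)) where

    edgeWeight-forestEdges-∷ : edgeWeight (lookup (xs ++ᵥ ys)) (forestEdges (h ∷ H))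
      ≈ edgeWeight (lookup xs) (starEdges h) * edgeWeight (lookup ys) (forestEdges H)
    edgeWeight-forestEdges-∷ = trans (edgeWeight-++ col (map (λ e → left (proj₁ e) , left (proj₂ e)) (starEdges h)) _)
      (reflexive (≡.cong₂ _*_
        (≡.trans (edgeWeight-map col left (starEdges h)) (edgeWeight-cong (lookup-++ˡ xs ys) (starEdges h)))
        (≡.trans (edgeWeight-map col right (forestEdges H)) (edgeWeight-cong (lookup-++ʳ xs ys) (forestEdges H)))))
      where
      col   = lookup (xs ++ᵥ ys)
      left  = _↑ˡ forestSize H
      right = suc h ↑ʳ_

    coneWeight-forestCentres-∷ : ∀ b → coneWeight b (lookup (xs ++ᵥ ys)) (forestCentres (h ∷ H))
      ≡ agree b (lookup xs zero) * coneWeight b (lookup ys) (forestCentres H)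
    coneWeight-forestCentres-∷ b = ≡.cong₂ _*_ (≡.cong (agree b) (lookup-++ˡ xs ys zero))
      (≡.trans (coneWeight-map b (lookup (xs ++ᵥ ys)) (suc h ↑ʳ_) (forestCentres H))
               (coneWeight-cong b (lookup-++ʳ xs ys) (forestCentres H)))

    forestWeight-∷ : ∀ b → forestWeight (h ∷ H) b (xs ++ᵥ ys) ≈ starWeight h b xs * forestWeight H b ys
    forestWeight-∷ b = begin
      (edgeWeight (lookup v) (forestEdges (h ∷ H)) * coneWeight b (lookup v) (forestCentres (h ∷ H)))
        * vprod mark v
        ≈⟨ *-cong (*-cong edgeWeight-forestEdges-∷ (reflexive (coneWeight-forestCentres-∷ b)))
                  (vprod-++ mark xs ys) ⟩
      ((Eₛ * E) * (a * C)) * (Mₛ * M)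
        ≈⟨ *-congʳ (interchange _ _ _ _) ⟩
      ((Eₛ * a) * (E * C)) * (Mₛ * M)
        ≈⟨ interchange _ _ _ _ ⟩
      starWeight h b xs * forestWeight H b ys ∎
      where
      v  = xs ++ᵥ ys
      Eₛ = edgeWeight (lookup xs) (starEdges h)
      E  = edgeWeight (lookup ys) (forestEdges H)
      a  = agree b (lookup xs zero)
      C  = coneWeight b (lookup ys) (forestCentres H)
      Mₛ = vprod mark xs
      M  = vprod mark ys

  forestSum : ∀ H b → sumR (map (forestWeight H b) (allSubsets (forestSize H))) ≈ prodR (map (starFactor b) H)
  forestSum []      b = trans (+-identityʳ _) (trans (*-identityʳ _) (*-identityʳ _))
  forestSum (h ∷ H) b = trans (sumR-allSubsets-++ (suc h) (forestSize H) (λ xs ys → forestWeight-∷ h H xs ys b))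
                              (*-cong (starSum h b) (forestSum H b))

  weight-∷ : ∀ H b v → weight (starsGraph H) (b ∷ v) ≈ mark b * forestWeight H b v
  weight-∷ H b v = begin
    weight (starsGraph H) (b ∷ v)
      ≈⟨ weight-factors (starsGraph H) (b ∷ v) ⟩
    edgeWeight (lookup (b ∷ v)) (edges (starsGraph H)) * (mark b * vprod mark v)
      ≈⟨ *-congʳ (edgeWeight-++ (lookup (b ∷ v)) (map (λ e → suc (proj₁ e) , suc (proj₂ e)) (forestEdges H)) _) ⟩
    (edgeWeight (lookup (b ∷ v)) (map (λ e → suc (proj₁ e) , suc (proj₂ e)) (forestEdges H))
      * edgeWeight (lookup (b ∷ v)) (map (λ c → zero , suc c) (forestCentres H))) * (mark b * vprod mark v)
      ≡⟨ ≡.cong₂ (λ e c → (e * c) * (mark b * vprod mark v))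
           (edgeWeight-map (lookup (b ∷ v)) suc (forestEdges H)) (edgeWeight-cone b v (forestCentres H)) ⟩
    (edgeWeight (lookup v) (forestEdges H) * coneWeight b (lookup v) (forestCentres H)) * (mark b * vprod mark v)
      ≈⟨ x∙yz≈y∙xz _ _ _ ⟩
    mark b * forestWeight H b v ∎

  sumR-weight-centre : ∀ H b →
    sumR (map (weight (starsGraph H)) (map (b ∷_) (allSubsets (forestSize H))))
      ≈ mark b * prodR (map (starFactor b) H)
  sumR-weight-centre H b = begin
    sumR (map (weight (starsGraph H)) (map (b ∷_) A))
      ≡⟨ ≡.cong sumR (≡.sym (List.map-∘ A)) ⟩
    sumR (map (weight (starsGraph H) ∘ (b ∷_)) A)
      ≈⟨ sumR-cong (weight-∷ H b) A ⟩
    sumR (map (λ v → mark b * forestWeight H b v) A)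
      ≈⟨ *-sumR (mark b) (forestWeight H b) A ⟨
    mark b * sumR (map (forestWeight H b) A)
      ≈⟨ *-congˡ (forestSum H b) ⟩
    mark b * prodR (map (starFactor b) H) ∎
    where A = allSubsets (forestSize H)

  Z-containing-centre : ∀ H →
    Z (starsGraph H) (singleton (cent H)) (emptySet (nV (starsGraph H))) t y
      ≈ y * prodR (map (starFactor true) H)
  Z-containing-centre H = trans
    (reflexive (≡.cong (sumR ∘ map (weight (starsGraph H)))
                       (admissible-containing-0 (forestSize H) (edges (starsGraph H)))))
    (sumR-weight-centre H true)

  Z-avoiding-centre : ∀ H →
    Z (starsGraph H) (emptySet (nV (starsGraph H))) (singleton (cent H)) t y
      ≈ prodR (map (starFactor false) H)
  Z-avoiding-centre H = trans
    (reflexive (≡.cong (sumR ∘ map (weight (starsGraph H)))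
                       (admissible-avoiding-0 (forestSize H) (edges (starsGraph H)))))
    (trans (sumR-weight-centre H false) (*-identityˡ _))

mainTheorem9 : {c ℓ : Level} (R : CommutativeSemiring c ℓ) →
    let open CommutativeSemiring R
        open Poly R
    in (H : List ℕ) → Unique H → All (λ h → 1 ≤ h) H → (t y : Carrier) →
       (Z (starsGraph H) (singleton (cent H)) (emptySet (nV (starsGraph H))) t y
          ≈ y * prodR (map (λ h → (y * t) * pow (y * t + 1#) h + pow (y + t) h) H))
       × (Z (starsGraph H) (emptySet (nV (starsGraph H))) (singleton (cent H)) t y
          ≈ prodR (map (λ h → y * pow (y * t + 1#) h + t * pow (y + t) h) H))
mainTheorem9 R H _ _ t y = Z-containing-centre H , Z-avoiding-centre H
  where open StarsWeights R t y
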